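{- Let $(G,L)$ be an instance of MLCM-P and consider a feasible line layout satisfying the periphery condition at every port. Let $l,l'$ be two lines such that an endpoint $v$ of their common subpath is a terminal of both $l$ and $l'$. If $l$ and $l'$ cross in this layout, then it can be transformed into a feasible line layout satisfying the periphery condition at every port that has fewer crossings and in which $l$ and $l'$ do not cross.
   Context: An instance $(G,L)$ consists of a graph $G=(V,E)$ embedded in the plane and a set $L$ of simple paths in $G$ (lines). The endpoints of a line are its terminals, the other vertices its intermediate stations. Standing assumption: two lines share at most one maximal common subpath (their common subpath). For an edge $(u,v)$, $L_{uv}$ is the set of lines containing it. Each vertex is a polygon with one side (port) per incident edge, in embedding order. A line layout specifies for every edge $(u,v)$ linear orders $\pi_{uv},\pi_{vu}$ of $L_{uv}$, $\pi_{uv}$ being the clockwise order (w.r.t. the center of $u$'s polygon) in which lines attach to the port of $u$ for $(u,v)$. Lines $l_1,l_2$ have an edge crossing on $(u,v)$ if $l_1$ precedes $l_2$ in both $\pi_{uv}$ and $\pi_{vu}$; with $\pi_u$ the cyclic concatenation of the orders at the ports of $u$ in clockwise order, they have a vertex crossing at $u$ if $\pi_u=(\dots l_1\dots l_2\dots l_1\dots l_2\dots)$. A crossing is unavoidable if it occurs in every layout. A layout is feasible if it has no avoidable vertex crossings; its number of crossings is its number of edge crossings. The order $\pi_{uv}$ satisfies the periphery condition if $\pi_{uv}=(l_1\dots l_p\,l_{p+1}\dots l_{q-1}\,l_q\dots l_m)$ where $u$ is a terminal of $l_1,\dots,l_p,l_q,\dots,l_m$ and an intermediate station of $l_{p+1},\dots,l_{q-1}$.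 MLCM-P asks for a feasible layout satisfying the periphery condition at every port with the minimum number of crossings. -}

module Defs where

open import Data.Nat using (ℕ; zero; suc; _+_; _*_; _<_; _≤ᵇ_; _<ᵇ_)
open import Data.Bool using (Bool; true; false; _∧_; _∨_; not; if_then_else_; T)
open import Data.Fin using (Fin; toℕ; _≟_)
open import Data.List using (List; []; _∷_; _++_; _∷ʳ_; reverse; map; concatMap; allFin; upTo; length; head; null)
open import Data.Nat.ListAction using (sum)
open import Data.Bool.ListAction using (any; all)
open import Data.List.Membership.Propositional using (_∈_)
open import Data.List.Relation.Unary.All using (All)
open import Data.List.Relation.Unary.Unique.Propositional using (Unique)
open import Data.List.Relation.Unary.Linked using (Linked)
open import Data.List.Relation.Binary.Sublist.Propositional using (_⊆_)
open import Data.Maybe using (Maybe; just; nothing; fromMaybe)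
open import Data.Product using (Σ; ∃; ∃₂; _×_; _,_)
open import Data.Sum using (_⊎_)
open import Relation.Nullary using (¬_; does)
open import Relation.Binary.PropositionalEquality using (_≡_; _≢_)
open import Function.Bundles using (_⇔_)

Infix : {A : Set} → List A → List A → Set
Infix {A} p l = ∃₂ λ (xs ys : List A) → l ≡ xs ++ p ++ ys

SubpathOf : {A : Set} → List A → List A → Set
SubpathOf p l = Infix p l ⊎ Infix (reverse p) l

EndpointOf : {A : Set} → A → List A → Set
EndpointOf {A} x l = (∃ λ (xs : List A) → l ≡ x ∷ xs) ⊎ (∃ λ (xs : List A) → l ≡ xs ∷ʳ x)

InnerOf : {A : Set} → A → List A → Set
InnerOf {A} x l = ∃₂ λ (xs ys : List A) → xs ≢ [] × ys ≢ [] × l ≡ xs ++ x ∷ ys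

UsesEdge : {A : Set} → List A → A → A → Set
UsesEdge l x y = Infix (x ∷ y ∷ []) l ⊎ Infix (y ∷ x ∷ []) l

IsRotationOf : {A : Set} → List A → List A → Set
IsRotationOf {A} r l = ∃₂ λ (xs ys : List A) → l ≡ xs ++ ys × r ≡ ys ++ xs

module Rotation (n : ℕ) (rot : Fin n → List (Fin n)) where

  eqᵇ : Fin n → Fin n → Bool
  eqᵇ x y = does (x ≟ y)

  memᵇ : Fin n → List (Fin n) → Bool
  memᵇ x = any (eqᵇ x)

  adjᵇ : Fin n → Fin n → Bool
  adjᵇ u w = memᵇ w (rot u)

  nextAfter : Fin n → List (Fin n) → Maybe (Fin n)
  nextAfter x [] = nothing
  nextAfter x (y ∷ ys) = if eqᵇ y x then head ys else nextAfter x ys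

  succAt : Fin n → Fin n → Fin n
  succAt v u = fromMaybe (fromMaybe u (head (rot v))) (nextAfter u (rot v))

  Dart : Set
  Dart = Fin n × Fin n

  darts : List Dart
  darts = concatMap (λ u → map (λ w → (u , w)) (rot u)) (allFin n)

  -- face-tracing permutation on darts
  φ : Dart → Dart
  φ (u , w) = (w , succAt w u)

  iter : ℕ → Dart → Dart
  iter zero d = d
  iter (suc m) d = φ (iter m d)

  code : Dart → ℕ
  code (u , w) = toℕ u * n + toℕ w

  orbitRep : Dart → Bool
  orbitRep d = all (λ i → code d ≤ᵇ code (iter i d)) (upTo (length darts))

  count : {A : Set} → (A → Bool) → List A → ℕ
  count p xs = sum (map (λ x → if p x then 1 else 0) xs)

  #faces : ℕ
  #faces = count orbitRep darts

  reach : ℕ → Fin n → Fin n → Bool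
  reach zero u w = eqᵇ u w
  reach (suc m) u w = reach m u w ∨ any (λ x → reach m u x ∧ adjᵇ x w) (allFin n)

  componentRep : Fin n → Bool
  componentRep u = all (λ w → not (reach n w u) ∨ (toℕ u ≤ᵇ toℕ w)) (allFin n)

  #components : ℕ
  #components = count componentRep (allFin n)

  #isolated : ℕ
  #isolated = count (λ u → null (rot u)) (allFin n)

  -- Euler's formula, summed over components (each component has genus 0):
  -- V - E + F + (#isolated) = 2C, with E = |darts|/2, multiplied by 2.
  Planar : Set
  Planar = 2 * n + 2 * #faces + 2 * #isolated ≡ 4 * #components + length darts

CommonSub : {A : Set} → List A → List A → List A → Set
CommonSub l l' p = p ≢ [] × SubpathOf p l × SubpathOf p l'

TheCommonSubpath : {A : Set} → List A → List A → List A → Set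
TheCommonSubpath l l' P = CommonSub l l' P × (∀ p → CommonSub l l' p → SubpathOf p P)

record Instance : Set where
  field
    n     : ℕ
    -- rot v = neighbours of v in clockwise order (= ports of v's polygon)
    rot   : Fin n → List (Fin n)
    rot-unique : ∀ v → Unique (rot v)
    rot-noloop : ∀ v → ¬ (v ∈ rot v)
    rot-sym    : ∀ u v → v ∈ rot u → u ∈ rot v
    planar     : Rotation.Planar n rot
    k     : ℕ
    line  : Fin k → List (Fin n)
    line-nontrivial : ∀ i → ∃₂ λ a b → ∃ λ xs → line i ≡ a ∷ b ∷ xs
    line-simple     : ∀ i → Unique (line i)
    line-path       : ∀ i → Linked (λ a b → b ∈ rot a) (line i)
    -- standing assumption: two lines share at most one maximal common subpath
    one-common      : ∀ i j → i ≢ j →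
                        (∀ p → ¬ CommonSub (line i) (line j) p)
                        ⊎ (Σ (List (Fin n)) λ P → TheCommonSubpath (line i) (line j) P)

module _ (I : Instance) where
  open Instance I

  V : Set
  V = Fin n

  L : Set
  L = Fin k

  -- A line layout: π u v is the clockwise order (w.r.t. u) in which the lines
  -- of L_uv attach to the port of u for edge (u,v).  For non-edges it is [].
  record Layout : Set where
    field
      π      : V → V → List L
      π-uniq : ∀ u v → Unique (π u v)
      π-mem  : ∀ u v (i : L) → (i ∈ π u v) ⇔ UsesEdge (line i) u v

  open Layout

  precedes : L → L → List L → Bool
  precedes i j [] = false
  precedes i j (x ∷ xs) = if does (x ≟ i) then any (λ y → does (y ≟ j)) xs else precedes i j xs

  edgeCrossᵇ : Layout → V → V → L → L → Bool
  edgeCrossᵇ Λ u v i j = precedes i j (π Λ u v) ∧ precedes i j (π Λ v u)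

  Cross : Layout → L → L → Set
  Cross Λ i j = ∃₂ λ (u v : V) → T (edgeCrossᵇ Λ u v i j) ⊎ T (edgeCrossᵇ Λ u v j i)

  -- number of (edge) crossings: each unordered edge {u,v} (u < v) and each
  -- crossing pair counted once (only the ordered pair (i,j) with i before j
  -- in both orders satisfies edgeCrossᵇ)
  crossings : Layout → ℕ
  crossings Λ =
    sum (map (λ u → sum (map (λ v →
      if toℕ u <ᵇ toℕ v
      then sum (map (λ i → sum (map (λ j → if edgeCrossᵇ Λ u v i j then 1 else 0) (allFin k))) (allFin k))
      else 0) (allFin n))) (allFin n))

  πAt : Layout → V → List L
  πAt Λ u = concatMap (π Λ u) (rot u)

  VertexCross : Layout → V → L → L → Set
  VertexCross Λ u i j = ∃ λ r → IsRotationOf r (πAt Λ u) × (i ∷ j ∷ i ∷ j ∷ []) ⊆ r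

  -- feasible: every vertex crossing is unavoidable (occurs in every layout)
  Feasible : Layout → Set
  Feasible Λ = ∀ u i j → VertexCross Λ u i j → (Λ' : Layout) → VertexCross Λ' u i j

  Terminal : V → L → Set
  Terminal u i = EndpointOf u (line i)

  Intermediate : V → L → Set
  Intermediate u i = InnerOf u (line i)

  PeripheryAt : Layout → V → V → Set
  PeripheryAt Λ u v = ∃ λ A → ∃₂ λ B C →
    π Λ u v ≡ A ++ B ++ C × All (Terminal u) A × All (Intermediate u) B × All (Terminal u) C

  Periphery : Layout → Set
  Periphery Λ = ∀ u v → PeripheryAt Λ u v

-- Orient the common subpath Q of l and l' so that it starts at v.  Since v is a terminal of
-- both lines, at every vertex of Q other than its last one the two lines use the same edges and
-- are both terminals or both intermediate stations.  If l and l' cross on an edge (a, b) of Q,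
-- exchange l and l' in all ports of the vertices of Q from v up to a.  Port orders stay valid,
-- vertex crossings are merely renamed and the periphery condition survives.  Edges with both or
-- no ends in the exchanged set keep their crossings, and (a, b) is the only edge leaving the set
-- that carries l: there the crossing of l and l' disappears while no crossing with a third line
-- is created.  Repeat while l and l' still cross; the number of crossings strictly decreases.

module Submission where

open import Defs
open import Data.Bool using (Bool; true; false; T; not; _∧_; _∨_; if_then_else_)
open import Data.Bool.ListAction using (any)
open import Data.Bool.Properties using (T-≡; T-∧; ∧-comm; ∧-zeroʳ)
open import Data.Empty using (⊥-elim)
open import Data.Fin using (Fin; _≟_; toℕ)
open import Data.Fin.Permutation.Components using (transpose)
open import Data.Fin.Properties using (<-cmp; any?)
open import Data.List using (List; []; _∷_; _++_; _∷ʳ_; reverse; map; allFin)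
open import Data.List.Membership.Propositional using (_∈_; _∉_)
open import Data.List.Membership.Propositional.Properties
  using (∈-++⁺ˡ; ∈-++⁺ʳ; ∈-∃++; ∈-map⁺; ∈-map⁻; ∈-allFin)
open import Data.List.Properties
  using (++-assoc; ++-conicalˡ; ++-conicalʳ; ∷-injective; ∷-injectiveˡ; ∷-injectiveʳ; ∷ʳ-injectiveʳ;
         map-++; map-concatMap; map-cong; map-cong-local;
         unfold-reverse; reverse-++; reverse-involutive; reverse-injective)
import Data.List.Relation.Binary.Sublist.Propositional.Properties as Sublist
open import Data.List.Relation.Unary.All using ([]; _∷_)
import Data.List.Relation.Unary.All as All
import Data.List.Relation.Unary.All.Properties as All
open import Data.List.Relation.Unary.AllPairs using ([]; _∷_)
open import Data.List.Relation.Unary.Any using (here; there)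
import Data.List.Relation.Unary.Any.Properties as Any
open import Data.List.Relation.Unary.Unique.Propositional using (Unique)
import Data.List.Relation.Unary.Unique.Propositional.Properties as Unique
open import Data.Nat using (ℕ; _+_; _≤_; _<_; z≤n; _<ᵇ_)
open import Data.Nat.Induction using (<-wellFounded)
open import Data.Nat.ListAction using (sum)
open import Data.Nat.Properties
  using (≤-refl; ≤-reflexive; ≤-trans; <-trans; ≤ᵇ⇒≤; <⇒<ᵇ; <⇒≤; m≤m+n; m≤n+m;
         +-assoc; +-mono-≤; +-mono-<-≤)
open import Data.Nat.Tactic.RingSolver using (solve-∀)
open import Data.Product using (Σ; ∃; ∃₂; _×_; _,_; proj₁; proj₂)
import Data.Product as Product
open import Data.Sum using (_⊎_; inj₁; inj₂)
open import Data.Unit using (tt)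
open import Function using (_∘′_)
open import Function.Bundles using (_⇔_; mk⇔; Equivalence)
import Induction.WellFounded as WF
open import Level using (0ℓ)
import Relation.Binary.Construct.On as On
open import Relation.Binary.Definitions using (tri<; tri≈; tri>)
open import Relation.Binary.PropositionalEquality
  using (_≡_; _≢_; refl; sym; trans; cong; cong₂; subst; subst₂)
open Relation.Binary.PropositionalEquality.≡-Reasoning
open import Relation.Nullary using (¬_; Dec; does; yes; no)
open import Relation.Nullary.Decidable using (T?; _⊎-dec_)
open import Relation.Unary using (Decidable)

-- Simple paths

module _ {A : Set} where

  unique-++⁻ˡ : ∀ (xs : List A) {ys} → Unique (xs ++ ys) → Unique xs
  unique-++⁻ˡ []       _         = []
  unique-++⁻ˡ (x ∷ xs) (x∉ ∷ u) = All.++⁻ˡ xs x∉ ∷ unique-++⁻ˡ xs u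

  unique-++⁻ʳ : ∀ (xs : List A) {ys} → Unique (xs ++ ys) → Unique ys
  unique-++⁻ʳ []       u       = u
  unique-++⁻ʳ (x ∷ xs) (_ ∷ u) = unique-++⁻ʳ xs u

  unique-++-disjoint : ∀ (xs : List A) {ys x} → Unique (xs ++ ys) → x ∈ xs → x ∉ ys
  unique-++-disjoint (_ ∷ xs) (x∉ ∷ _) (here refl) x∈ys = All.lookup (All.++⁻ʳ xs x∉) x∈ys refl
  unique-++-disjoint (_ ∷ xs) (_ ∷ u)  (there x∈xs) = unique-++-disjoint xs u x∈xs

  unique-reverse : ∀ {xs : List A} → Unique xs → Unique (reverse xs)
  unique-reverse {[]}     u        = u
  unique-reverse {x ∷ xs} (x∉ ∷ u) rewrite unfold-reverse x xs =
    Unique.++⁺ (unique-reverse u) ([] ∷ [])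
      (λ { (x∈ , here refl) → All.lookup x∉ (Any.reverse⁻ x∈) refl })

  unique-split : ∀ (as : List A) {x bs cs ds} → Unique (as ++ x ∷ bs) →
                 as ++ x ∷ bs ≡ cs ++ x ∷ ds → as ≡ cs × bs ≡ ds
  unique-split []       {cs = []}     _        refl = refl , refl
  unique-split []       {cs = c ∷ cs} (x∉ ∷ _) eq with refl , eq′ ← ∷-injective eq =
    ⊥-elim (All.lookup x∉ (subst (_ ∈_) (sym eq′) (∈-++⁺ʳ cs (here refl))) refl)
  unique-split (a ∷ as) {cs = []}     (a∉ ∷ _) eq with refl , _ ← ∷-injective eq =
    ⊥-elim (All.lookup a∉ (∈-++⁺ʳ as (here refl)) refl)
  unique-split (a ∷ as) {cs = c ∷ cs} (_ ∷ u)  eq with refl , eq′ ← ∷-injective eq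
    with refl , refl ← unique-split as u eq′ = refl , refl

  infix-trans : ∀ {p q l : List A} → Infix p q → Infix q l → Infix p l
  infix-trans {p} (a , b , refl) (c , d , refl) = c ++ a , b ++ d , eq
    where
    eq : c ++ (a ++ p ++ b) ++ d ≡ (c ++ a) ++ p ++ b ++ d
    eq rewrite ++-assoc a (p ++ b) d | ++-assoc p b d | ++-assoc c a (p ++ b ++ d) = refl

  infix-reverse : ∀ {p l : List A} → Infix p l → Infix (reverse p) (reverse l)
  infix-reverse {p} (xs , ys , refl) = reverse ys , reverse xs , eq
    where
    eq : reverse (xs ++ p ++ ys) ≡ reverse ys ++ reverse p ++ reverse xs
    eq rewrite reverse-++ xs (p ++ ys) | reverse-++ p ys
             | ++-assoc (reverse ys) (reverse p) (reverse xs) = refl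

  infix-reverse′ : ∀ {p l : List A} → Infix (reverse p) l → Infix p (reverse l)
  infix-reverse′ {p} {l} i = subst (λ q → Infix q (reverse l)) (reverse-involutive p) (infix-reverse i)

  usesEdge-sym : ∀ {l : List A} {x y} → UsesEdge l x y → UsesEdge l y x
  usesEdge-sym (inj₁ i) = inj₂ i
  usesEdge-sym (inj₂ i) = inj₁ i

  usesEdge-reverse : ∀ {l : List A} {x y} → UsesEdge l x y → UsesEdge (reverse l) x y
  usesEdge-reverse (inj₁ i) = inj₂ (infix-reverse i)
  usesEdge-reverse (inj₂ i) = inj₁ (infix-reverse i)

  unique-subpath : ∀ {q l : List A} → Unique l → SubpathOf q l → Unique q
  unique-subpath {q} u (inj₁ (xs , _ , refl)) = unique-++⁻ˡ q (unique-++⁻ʳ xs u)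
  unique-subpath {q} u (inj₂ (xs , _ , refl)) =
    subst Unique (reverse-involutive q) (unique-reverse (unique-++⁻ˡ (reverse q) (unique-++⁻ʳ xs u)))

  subpath-reverse : ∀ {p l : List A} → SubpathOf p l → SubpathOf (reverse p) l
  subpath-reverse {p} {l} (inj₁ i) = inj₂ (subst (λ q → Infix q l) (sym (reverse-involutive p)) i)
  subpath-reverse         (inj₂ i) = inj₁ i

  usesEdge-infix : ∀ {q l : List A} {x y} → UsesEdge q x y → Infix q l → UsesEdge l x y
  usesEdge-infix (inj₁ e) i = inj₁ (infix-trans e i)
  usesEdge-infix (inj₂ e) i = inj₂ (infix-trans e i)

  usesEdge-subpath : ∀ {q l : List A} {x y} → UsesEdge q x y → SubpathOf q l → UsesEdge l x y
  usesEdge-subpath e (inj₁ i) = usesEdge-infix e i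
  usesEdge-subpath e (inj₂ i) = usesEdge-infix (usesEdge-reverse e) i

  endpoint-reverse : ∀ {l : List A} {x} → EndpointOf x l → EndpointOf x (reverse l)
  endpoint-reverse {x = x} (inj₁ (xs , refl)) = inj₂ (reverse xs , unfold-reverse x xs)
  endpoint-reverse {x = x} (inj₂ (xs , refl)) = inj₁ (reverse xs , reverse-++ xs (x ∷ []))

  inner-reverse : ∀ {l : List A} {x} → InnerOf x l → InnerOf x (reverse l)
  inner-reverse {x = x} (xs , ys , xs≢[] , ys≢[] , refl) =
    reverse ys , reverse xs , ys≢[] ∘′ reverse-injective , xs≢[] ∘′ reverse-injective , eq
    where
    eq : reverse (xs ++ x ∷ ys) ≡ reverse ys ++ x ∷ reverse xs
    eq rewrite reverse-++ xs (x ∷ ys) | unfold-reverse x ys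
             | ++-assoc (reverse ys) (x ∷ []) (reverse xs) = refl

  endpoint⇒¬inner : ∀ {l : List A} {x} → Unique l → EndpointOf x l → ¬ InnerOf x l
  endpoint⇒¬inner u (inj₁ (zs , refl)) (xs , ys , xs≢[] , _ , eq) =
    xs≢[] (sym (proj₁ (unique-split [] u eq)))
  endpoint⇒¬inner u (inj₂ (zs , refl)) (xs , ys , _ , ys≢[] , eq) =
    ys≢[] (sym (proj₂ (unique-split zs u eq)))

  infix⇒inner : ∀ {l xs ys : List A} {x} → Infix (xs ++ x ∷ ys) l → xs ≢ [] → ys ≢ [] → InnerOf x l
  infix⇒inner {xs = xs} {ys} {x} (as , bs , refl) xs≢[] ys≢[] =
    as ++ xs , ys ++ bs ,
    xs≢[] ∘′ ++-conicalʳ as xs , ys≢[] ∘′ ++-conicalˡ ys bs ,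
    trans (cong (as ++_) (++-assoc xs (x ∷ ys) bs)) (sym (++-assoc as xs (x ∷ ys ++ bs)))

  subpath⇒inner : ∀ {l xs ys : List A} {x} → SubpathOf (xs ++ x ∷ ys) l → xs ≢ [] → ys ≢ [] → InnerOf x l
  subpath⇒inner (inj₁ i) xs≢[] ys≢[] = infix⇒inner i xs≢[] ys≢[]
  subpath⇒inner {l} (inj₂ i) xs≢[] ys≢[] =
    subst (InnerOf _) (reverse-involutive l) (inner-reverse (infix⇒inner (infix-reverse′ i) xs≢[] ys≢[]))

  usesEdge-neighbour : ∀ (xs : List A) {x zs y} → Unique (xs ++ x ∷ zs) → UsesEdge (xs ++ x ∷ zs) x y →
                       (∃ λ zs′ → zs ≡ y ∷ zs′) ⊎ (∃ λ xs′ → xs ≡ xs′ ∷ʳ y)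
  usesEdge-neighbour xs u (inj₁ (as , bs , eq)) = inj₁ (bs , proj₂ (unique-split xs u eq))
  usesEdge-neighbour xs {x} {y = y} u (inj₂ (as , bs , eq)) =
    inj₂ (as , proj₁ (unique-split xs u (trans eq (sym (++-assoc as (y ∷ []) (x ∷ bs))))))

  ++-head : ∀ (ys : List A) {B y zs} → ys ≢ [] → ys ++ B ≡ y ∷ zs → ∃ λ ys′ → ys ≡ y ∷ ys′
  ++-head []       ys≢[] _  = ⊥-elim (ys≢[] refl)
  ++-head (_ ∷ ys) _     eq with refl ← ∷-injectiveˡ eq = ys , refl

  singleton≡++∷ : ∀ (xs : List A) {v x ys} → v ∷ [] ≡ xs ++ x ∷ ys → ys ≡ []
  singleton≡++∷ []           eq = sym (∷-injectiveʳ eq)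
  singleton≡++∷ (_ ∷ [])     ()
  singleton≡++∷ (_ ∷ _ ∷ _)  ()

  prefix-usesEdge : ∀ {l Q B xs ys : List A} {x y} → l ≡ Q ++ B → Q ≡ xs ++ x ∷ ys → ys ≢ [] →
                    Unique l → UsesEdge l x y → UsesEdge Q x y
  prefix-usesEdge {B = B} {xs} {ys} {x} refl refl ys≢[] u e
    rewrite ++-assoc xs (x ∷ ys) B with usesEdge-neighbour xs u e
  ... | inj₁ (zs′ , eq) with ys′ , refl ← ++-head ys ys≢[] eq = inj₁ (xs , ys′ , refl)
  ... | inj₂ (xs′ , refl) = inj₂ (xs′ , ys , ++-assoc xs′ (_ ∷ []) (x ∷ ys))

  endpoint-infix⇒prefix : ∀ {l R : List A} {v} → Unique l → EndpointOf v l → Infix (v ∷ R) l → R ≢ [] →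
                          ∃ λ B → l ≡ (v ∷ R) ++ B
  endpoint-infix⇒prefix u (inj₁ (zs , refl)) (as , B , eq) _ with refl ← proj₁ (unique-split [] u eq) = B , eq
  endpoint-infix⇒prefix {R = R} u (inj₂ (zs , refl)) (as , B , eq) R≢[] =
    ⊥-elim (R≢[] (++-conicalˡ R B (sym (proj₂ (unique-split zs u eq)))))

  -- v ∷ R is a prefix of l, and it contains both neighbours of x in l.
  infixFromEndpoint-usesEdge : ∀ {l R xs ys : List A} {v x y} → Unique l → EndpointOf v l →
    Infix (v ∷ R) l → v ∷ R ≡ xs ++ x ∷ ys → ys ≢ [] → UsesEdge l x y → UsesEdge (v ∷ R) x y
  infixFromEndpoint-usesEdge {R = R} {xs} u end i eqR ys≢[] =
    prefix-usesEdge (proj₂ (endpoint-infix⇒prefix u end i R≢[])) eqR ys≢[] u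
    where
    R≢[] : R ≢ []
    R≢[] refl = ys≢[] (singleton≡++∷ xs eqR)

  subpathFromEndpoint-usesEdge : ∀ {l R xs ys : List A} {v x y} → Unique l → EndpointOf v l →
    SubpathOf (v ∷ R) l → v ∷ R ≡ xs ++ x ∷ ys → ys ≢ [] → UsesEdge l x y → UsesEdge (v ∷ R) x y
  subpathFromEndpoint-usesEdge u end (inj₁ i) eqR ys≢[] e = infixFromEndpoint-usesEdge u end i eqR ys≢[] e
  subpathFromEndpoint-usesEdge u end (inj₂ i) eqR ys≢[] e =
    infixFromEndpoint-usesEdge (unique-reverse u) (endpoint-reverse end) (infix-reverse′ i) eqR ys≢[]
      (usesEdge-reverse e)

  split-++ : ∀ {xs s₁ s₂ ys : List A} {x} → xs ≡ s₁ ++ x ∷ s₂ → xs ++ ys ≡ s₁ ++ x ∷ (s₂ ++ ys)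
  split-++ {s₁ = s₁} {s₂} {ys} {x} refl = ++-assoc s₁ (x ∷ s₂) ys

  usesEdge-leaving : ∀ (pre : List A) {a b post x y} → Unique ((pre ∷ʳ a) ++ b ∷ post) →
                     x ∈ pre ∷ʳ a → y ∉ pre ∷ʳ a → UsesEdge ((pre ∷ʳ a) ++ b ∷ post) x y → x ≡ a × y ≡ b
  usesEdge-leaving pre {a} {b} {post} {x} {y} u x∈ y∉ e
    with s₁ , s₂ , eq ← ∈-∃++ x∈
    with usesEdge-neighbour s₁ (subst Unique (split-++ eq) u) (subst (λ p → UsesEdge p x y) (split-++ eq) e)
  ... | inj₂ (s₁′ , refl) = ⊥-elim (y∉ (subst (y ∈_) (sym eq) (∈-++⁺ˡ (∈-++⁺ʳ s₁′ (here refl)))))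
  ... | inj₁ (zs′ , eq′) with s₂
  ...   | []     with refl ← ∷-injectiveˡ eq′ = sym (∷ʳ-injectiveʳ pre s₁ eq) , refl
  ...   | z ∷ s₂′ with refl ← ∷-injectiveˡ eq′ =
    ⊥-elim (y∉ (subst (y ∈_) (sym eq) (∈-++⁺ʳ s₁ (there (here refl)))))

-- Sums over Fin

sum-map-mono : ∀ {A : Set} (xs : List A) {f g : A → ℕ} → (∀ x → f x ≤ g x) → sum (map f xs) ≤ sum (map g xs)
sum-map-mono []       _   = z≤n
sum-map-mono (x ∷ xs) f≤g = +-mono-≤ (f≤g x) (sum-map-mono xs f≤g)

sum-map-+ : ∀ {A : Set} (xs : List A) (f g : A → ℕ) →
            sum (map (λ x → f x + g x) xs) ≡ sum (map f xs) + sum (map g xs)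
sum-map-+ []       f g = refl
sum-map-+ (x ∷ xs) f g rewrite sum-map-+ xs f g = +-+-swap (f x) (g x) (sum (map f xs)) (sum (map g xs))
  where
  +-+-swap : ∀ a b c d → a + b + (c + d) ≡ a + c + (b + d)
  +-+-swap = solve-∀

module _ {k : ℕ} where

  ∑ : (Fin k → ℕ) → ℕ
  ∑ f = sum (map f (allFin k))

  ∑-cong : ∀ {f g : Fin k → ℕ} → (∀ i → f i ≡ g i) → ∑ f ≡ ∑ g
  ∑-cong f≗g = cong sum (map-cong f≗g (allFin k))

  ∑-mono : ∀ {f g : Fin k → ℕ} → (∀ i → f i ≤ g i) → ∑ f ≤ ∑ g
  ∑-mono = sum-map-mono (allFin k)

  ∑-+ : ∀ (f g : Fin k → ℕ) → ∑ (λ i → f i + g i) ≡ ∑ f + ∑ g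
  ∑-+ = sum-map-+ (allFin k)

  zeroAt : Fin k → (Fin k → ℕ) → Fin k → ℕ
  zeroAt a h i = if does (i ≟ a) then 0 else h i

  zeroAt-≢ : ∀ {a i} h → i ≢ a → zeroAt a h i ≡ h i
  zeroAt-≢ {a} {i} h i≢a with i ≟ a
  ... | yes i≡a = ⊥-elim (i≢a i≡a)
  ... | no _    = refl

  zeroAt-mono : ∀ a {f g : Fin k → ℕ} i → (i ≢ a → f i ≤ g i) → zeroAt a f i ≤ zeroAt a g i
  zeroAt-mono a i fi≤gi with i ≟ a
  ... | yes _   = z≤n
  ... | no i≢a = fi≤gi i≢a

  sum-map-extract : ∀ {xs} a (h : Fin k → ℕ) → Unique xs → a ∈ xs →
                    sum (map h xs) ≡ h a + sum (map (zeroAt a h) xs)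
  sum-map-extract {x ∷ xs} a h (x∉ ∷ _) (here refl) with x ≟ x
  ... | no x≢x = ⊥-elim (x≢x refl)
  ... | yes _  = cong (h x +_) (cong sum (map-cong-local (All.map unchanged x∉)))
    where
    unchanged : ∀ {i} → x ≢ i → h i ≡ zeroAt x h i
    unchanged {i} x≢i with i ≟ x
    ... | yes refl = ⊥-elim (x≢i refl)
    ... | no _     = refl
  sum-map-extract {x ∷ xs} a h (x∉ ∷ u) (there a∈) with x ≟ a
  ... | yes refl = ⊥-elim (All.lookup x∉ a∈ refl)
  ... | no _ rewrite sum-map-extract a h u a∈ = +-comm-middle (h x) (h a) (sum (map (zeroAt a h) xs))
    where
    +-comm-middle : ∀ m n o → m + (n + o) ≡ n + (m + o)
    +-comm-middle = solve-∀

  ∑-extract : ∀ a (h : Fin k → ℕ) → ∑ h ≡ h a + ∑ (zeroAt a h)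
  ∑-extract a h = sum-map-extract a h (Unique.allFin⁺ k) (∈-allFin a)

  ∑-mono-< : ∀ {f g : Fin k → ℕ} a → (∀ i → f i ≤ g i) → f a < g a → ∑ f < ∑ g
  ∑-mono-< {f} {g} a f≤g fa<ga rewrite ∑-extract a f | ∑-extract a g =
    +-mono-<-≤ fa<ga (∑-mono (λ i → zeroAt-mono a {f} {g} i (λ _ → f≤g i)))

  ordered : (Fin k → Fin k → ℕ) → Fin k → Fin k → ℕ
  ordered f u v = if toℕ u <ᵇ toℕ v then f u v else 0

  ∑< : (Fin k → Fin k → ℕ) → ℕ
  ∑< f = ∑ λ u → ∑ (ordered f u)

  ordered-mono : ∀ {f g : Fin k → Fin k → ℕ} → (∀ u v → f u v ≤ g u v) → ∀ u v → ordered f u v ≤ ordered g u v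
  ordered-mono f≤g u v with toℕ u <ᵇ toℕ v
  ... | true  = f≤g u v
  ... | false = z≤n

  ∑<-mono-<-at : ∀ {f g : Fin k → Fin k → ℕ} {a b} → toℕ a < toℕ b → (∀ u v → f u v ≤ g u v) →
                 f a b < g a b → ∑< f < ∑< g
  ∑<-mono-<-at {f} {g} {a} {b} a<b f≤g ab< =
    ∑-mono-< a (λ u → ∑-mono (ordered-mono f≤g u)) (∑-mono-< b (ordered-mono f≤g a) ordered<)
    where
    ordered< : ordered f a b < ordered g a b
    ordered< rewrite Equivalence.to T-≡ (<⇒<ᵇ a<b) = ab<

  ∑<-mono-< : ∀ {f g : Fin k → Fin k → ℕ} {a b} → a ≢ b → (∀ u v → f u v ≤ g u v) →
              f a b < g a b → f b a < g b a → ∑< f < ∑< g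
  ∑<-mono-< {a = a} {b} a≢b f≤g ab< ba< with <-cmp a b
  ... | tri< a<b _ _ = ∑<-mono-<-at a<b f≤g ab<
  ... | tri≈ _ a≡b _ = ⊥-elim (a≢b a≡b)
  ... | tri> _ _ b<a = ∑<-mono-<-at b<a f≤g ba<

  module AroundPair (a b : Fin k) (a≢b : a ≢ b) where

    outside : (Fin k → ℕ) → Fin k → ℕ
    outside h = zeroAt b (zeroAt a h)

    outside-+ : ∀ f g i → outside (λ i → f i + g i) i ≡ outside f i + outside g i
    outside-+ f g i with i ≟ a | i ≟ b
    ... | yes _ | yes _ = refl
    ... | yes _ | no _  = refl
    ... | no _  | yes _ = refl
    ... | no _  | no _  = refl

    outside-cong : ∀ {f g} → (∀ i → f i ≡ g i) → ∀ i → outside f i ≡ outside g i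
    outside-cong f≗g i = cong (λ x → if does (i ≟ b) then 0 else (if does (i ≟ a) then 0 else x)) (f≗g i)

    outside-mono : ∀ {f g} → (∀ i → i ≢ a → i ≢ b → f i ≤ g i) → ∀ i → outside f i ≤ outside g i
    outside-mono {f} {g} f≤g i = zeroAt-mono b {zeroAt a f} {zeroAt a g} i (λ i≢b → zeroAt-mono a {f} {g} i (λ i≢a → f≤g i i≢a i≢b))

    ∑-extract₂ : ∀ h → ∑ h ≡ h a + h b + ∑ (outside h)
    ∑-extract₂ h rewrite ∑-extract a h | ∑-extract b (zeroAt a h) | zeroAt-≢ h (a≢b ∘′ sym) =
      sym (+-assoc (h a) (h b) (∑ (outside h)))

    ∑∑ : (Fin k → Fin k → ℕ) → ℕ
    ∑∑ F = ∑ λ i → ∑ (F i)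

    block : (Fin k → Fin k → ℕ) → ℕ
    block F = F a a + F a b + (F b a + F b b)

    strip : (Fin k → Fin k → ℕ) → Fin k → ℕ
    strip F m = F a m + F b m + (F m a + F m b)

    interior : (Fin k → Fin k → ℕ) → ℕ
    interior F = ∑ (outside λ i → ∑ (outside (F i)))

    ∑∑-split : ∀ F → ∑∑ F ≡ block F + ∑ (outside (strip F)) + interior F
    ∑∑-split F = begin
      ∑ (λ i → ∑ (F i))
        ≡⟨ ∑-extract₂ (λ i → ∑ (F i)) ⟩
      ∑ (F a) + ∑ (F b) + ∑ (outside λ i → ∑ (F i))
        ≡⟨ cong₂ _+_ (cong₂ _+_ (∑-extract₂ (F a)) (∑-extract₂ (F b))) rows ⟩
      (F a a + F a b + ∑ (outside (F a))) + (F b a + F b b + ∑ (outside (F b))) + (∑ (outside col) + interior F)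
        ≡⟨ rearrange (F a a) (F a b) (F b a) (F b b) (∑ (outside (F a))) (∑ (outside (F b))) _ _ ⟩
      block F + (∑ (outside (F a)) + ∑ (outside (F b)) + ∑ (outside col)) + interior F
        ≡⟨ cong (λ t → block F + t + interior F) strips ⟨
      block F + ∑ (outside (strip F)) + interior F ∎
      where
      col : Fin k → ℕ
      col i = F i a + F i b
      rows : ∑ (outside λ i → ∑ (F i)) ≡ ∑ (outside col) + interior F
      rows = trans (∑-cong λ i → trans (outside-cong (λ i → ∑-extract₂ (F i)) i) (outside-+ col (λ i → ∑ (outside (F i))) i))
                   (∑-+ (outside col) _)
      strips : ∑ (outside (strip F)) ≡ ∑ (outside (F a)) + ∑ (outside (F b)) + ∑ (outside col)
      strips = begin
        ∑ (outside (strip F))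
          ≡⟨ ∑-cong (λ m → trans (outside-+ (λ m → F a m + F b m) col m) (cong (_+ outside col m) (outside-+ (F a) (F b) m))) ⟩
        ∑ (λ m → outside (F a) m + outside (F b) m + outside col m)
          ≡⟨ ∑-+ (λ m → outside (F a) m + outside (F b) m) (outside col) ⟩
        ∑ (λ m → outside (F a) m + outside (F b) m) + ∑ (outside col)
          ≡⟨ cong (_+ ∑ (outside col)) (∑-+ (outside (F a)) (outside (F b))) ⟩
        ∑ (outside (F a)) + ∑ (outside (F b)) + ∑ (outside col) ∎
      rearrange : ∀ p q r s x y z w → (p + q + x) + (r + s + y) + (z + w) ≡ (p + q + (r + s)) + (x + y + z) + w
      rearrange = solve-∀

    interior-mono : ∀ F G → (∀ i j → i ≢ a → i ≢ b → j ≢ a → j ≢ b → F i j ≤ G i j) → interior F ≤ interior G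
    interior-mono F G F≤G =
      ∑-mono (outside-mono λ i i≢a i≢b → ∑-mono (outside-mono λ j j≢a j≢b → F≤G i j i≢a i≢b j≢a j≢b))

    ∑∑-mono : ∀ F G → block F ≤ block G → (∀ m → m ≢ a → m ≢ b → strip F m ≤ strip G m) →
              (∀ i j → i ≢ a → i ≢ b → j ≢ a → j ≢ b → F i j ≤ G i j) → ∑∑ F ≤ ∑∑ G
    ∑∑-mono F G block≤ strip≤ interior≤ rewrite ∑∑-split F | ∑∑-split G =
      +-mono-≤ (+-mono-≤ block≤ (∑-mono (outside-mono strip≤))) (interior-mono F G interior≤)

    ∑∑-mono-< : ∀ F G → block F < block G → (∀ m → m ≢ a → m ≢ b → strip F m ≤ strip G m) →
                (∀ i j → i ≢ a → i ≢ b → j ≢ a → j ≢ b → F i j ≤ G i j) → ∑∑ F < ∑∑ G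
    ∑∑-mono-< F G block< strip≤ interior≤ rewrite ∑∑-split F | ∑∑-split G =
      +-mono-<-≤ (+-mono-<-≤ block< (∑-mono (outside-mono strip≤))) (interior-mono F G interior≤)

-- Port orders and edge crossings

ind : Bool → ℕ
ind b = if b then 1 else 0

¬T⇒≡false : ∀ {b} → ¬ T b → b ≡ false
¬T⇒≡false {false} _ = refl
¬T⇒≡false {true}  ¬t = ⊥-elim (¬t tt)

module Precedence (I : Instance) where
  open Instance I using (k)

  Precedes : Fin k → Fin k → List (Fin k) → Set
  Precedes i j xs = T (precedes I i j xs)

  T-any-≟⇔∈ : ∀ {j : Fin k} xs → T (any (λ y → does (y ≟ j)) xs) ⇔ j ∈ xs
  T-any-≟⇔∈ {j} xs = mk⇔ (to xs) (from xs)
    where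
    to : ∀ xs → T (any (λ y → does (y ≟ j)) xs) → j ∈ xs
    to (x ∷ xs) t with x ≟ j
    ... | yes refl = here refl
    ... | no _     = there (to xs t)
    from : ∀ xs → j ∈ xs → T (any (λ y → does (y ≟ j)) xs)
    from (x ∷ xs) j∈ with x ≟ j | j∈
    ... | yes _ | _           = tt
    ... | no x≢j | here refl  = ⊥-elim (x≢j refl)
    ... | no _  | there j∈xs = from xs j∈xs

  precedes⇒∈ : ∀ {i j} xs → Precedes i j xs → i ∈ xs × j ∈ xs
  precedes⇒∈ {i} (x ∷ xs) t with x ≟ i
  ... | yes refl = here refl , there (Equivalence.to (T-any-≟⇔∈ xs) t)
  ... | no _     = Product.map there there (precedes⇒∈ xs t)

  precedes-asym : ∀ {i j} xs → Unique xs → Precedes i j xs → ¬ Precedes j i xs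
  precedes-asym {i} {j} (x ∷ xs) (x∉ ∷ u) t t′ with x ≟ i | x ≟ j
  ... | yes refl | yes refl = All.lookup x∉ (Equivalence.to (T-any-≟⇔∈ xs) t) refl
  ... | yes refl | no _     = All.lookup x∉ (proj₂ (precedes⇒∈ xs t′)) refl
  ... | no _     | yes refl = All.lookup x∉ (proj₂ (precedes⇒∈ xs t)) refl
  ... | no _     | no _     = precedes-asym xs u t t′

  precedes-total : ∀ {i j} xs → i ∈ xs → j ∈ xs → i ≢ j → Precedes i j xs ⊎ Precedes j i xs
  precedes-total {i} {j} (x ∷ xs) i∈ j∈ i≢j with x ≟ i | x ≟ j | i∈ | j∈
  ... | yes refl | _        | _         | here refl  = ⊥-elim (i≢j refl)
  ... | yes refl | _        | _         | there j∈xs = inj₁ (Equivalence.from (T-any-≟⇔∈ xs) j∈xs)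
  ... | no x≢i   | _        | here refl | _          = ⊥-elim (x≢i refl)
  ... | no _     | yes refl | there i∈xs | _         = inj₂ (Equivalence.from (T-any-≟⇔∈ xs) i∈xs)
  ... | no _     | no x≢j   | there _   | here refl  = ⊥-elim (x≢j refl)
  ... | no _     | no _     | there i∈xs | there j∈xs = precedes-total xs i∈xs j∈xs i≢j

  precedes-trans : ∀ {i j m} xs → Unique xs → Precedes i j xs → Precedes j m xs → Precedes i m xs
  precedes-trans {i} {j} (x ∷ xs) (x∉ ∷ u) t t′ with x ≟ i | x ≟ j
  ... | yes refl | yes refl = ⊥-elim (All.lookup x∉ (Equivalence.to (T-any-≟⇔∈ xs) t) refl)
  ... | yes refl | no _     = Equivalence.from (T-any-≟⇔∈ xs) (proj₂ (precedes⇒∈ xs t′))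
  ... | no _     | yes refl = ⊥-elim (All.lookup x∉ (proj₂ (precedes⇒∈ xs t)) refl)
  ... | no _     | no _     = precedes-trans xs u t t′

  precedes-irrefl : ∀ {i} xs → Unique xs → precedes I i i xs ≡ false
  precedes-irrefl {i} xs u = ¬T⇒≡false (λ t → precedes-asym xs u t t)

  precedes-asym′ : ∀ {i j} xs → Unique xs → Precedes i j xs → precedes I j i xs ≡ false
  precedes-asym′ xs u t = ¬T⇒≡false (precedes-asym xs u t)

  precedes-flip : ∀ {i j} xs → Unique xs → i ∈ xs → j ∈ xs → i ≢ j →
                  precedes I j i xs ≡ not (precedes I i j xs)
  precedes-flip {i} {j} xs u i∈ j∈ i≢j with precedes I i j xs in eq
  ... | true  = precedes-asym′ xs u (subst T (sym eq) tt)
  ... | false with precedes-total xs i∈ j∈ i≢j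
  ...   | inj₁ t = ⊥-elim (subst T eq t)
  ...   | inj₂ t = Equivalence.to T-≡ t

  precedes-∉ˡ : ∀ {i j} xs → i ∉ xs → precedes I i j xs ≡ false
  precedes-∉ˡ xs i∉ = ¬T⇒≡false (i∉ ∘′ proj₁ ∘′ precedes⇒∈ xs)

  precedes-∉ʳ : ∀ {i j} xs → j ∉ xs → precedes I i j xs ≡ false
  precedes-∉ʳ xs j∉ = ¬T⇒≡false (j∉ ∘′ proj₂ ∘′ precedes⇒∈ xs)

  module _ (σ : Fin k → Fin k) (σ-involutive : ∀ i → σ (σ i) ≡ i) where

    private
      σ-≟ : ∀ x i → does (σ x ≟ i) ≡ does (x ≟ σ i)
      σ-≟ x i with σ x ≟ i | x ≟ σ i
      ... | yes _    | yes _    = refl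
      ... | no _     | no _     = refl
      ... | yes refl | no x≢    = ⊥-elim (x≢ (sym (σ-involutive x)))
      ... | no σx≢   | yes refl = ⊥-elim (σx≢ (σ-involutive _))

      any-map : ∀ j xs → any (λ y → does (y ≟ j)) (map σ xs) ≡ any (λ y → does (y ≟ σ j)) xs
      any-map j []       = refl
      any-map j (x ∷ xs) = cong₂ _∨_ (σ-≟ x j) (any-map j xs)

    precedes-map : ∀ i j xs → precedes I i j (map σ xs) ≡ precedes I (σ i) (σ j) xs
    precedes-map i j []       = refl
    precedes-map i j (x ∷ xs) rewrite σ-≟ x i | any-map j xs | precedes-map i j xs = refl

  crossPair : List (Fin k) → List (Fin k) → Fin k → Fin k → ℕ
  crossPair X Y i j = ind (precedes I i j X ∧ precedes I i j Y)

  edgeCrossings : List (Fin k) → List (Fin k) → ℕ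
  edgeCrossings X Y = ∑ λ i → ∑ (crossPair X Y i)

  edgeCrossings-comm : ∀ X Y → edgeCrossings X Y ≡ edgeCrossings Y X
  edgeCrossings-comm X Y = ∑-cong λ i → ∑-cong λ j → cong ind (∧-comm (precedes I i j X) (precedes I i j Y))

-- For a third line m on an edge, p and q say whether l and l' precede m at one end, and r and s
-- the same at the other end.  If l and l' appear in the same order at both ends, exchanging l and
-- l' at the first end does not increase the number of crossings of m with l and l'.
exchange-≤ : ∀ p q r s → ((T q → T p) × (T s → T r)) ⊎ ((T p → T q) × (T r → T s)) →
             ind (q ∧ r) + ind (p ∧ s) + (ind (not q ∧ not r) + ind (not p ∧ not s))
               ≤ ind (p ∧ r) + ind (q ∧ s) + (ind (not p ∧ not r) + ind (not q ∧ not s))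
exchange-≤ true  true  r     s     _                 = ≤-refl
exchange-≤ false false r     s     _                 = ≤-refl
exchange-≤ true  false _     _     (inj₂ (p⇒q , _)) = ⊥-elim (p⇒q tt)
exchange-≤ false true  _     _     (inj₁ (q⇒p , _)) = ⊥-elim (q⇒p tt)
exchange-≤ true  false false true  (inj₁ (_ , s⇒r)) = ⊥-elim (s⇒r tt)
exchange-≤ false true  true  false (inj₂ (_ , r⇒s)) = ⊥-elim (r⇒s tt)
exchange-≤ true  false true  true  _                 = ≤ᵇ⇒≤ _ _ tt
exchange-≤ true  false true  false _                 = ≤ᵇ⇒≤ _ _ tt
exchange-≤ true  false false false _                 = ≤ᵇ⇒≤ _ _ tt
exchange-≤ false true  true  true  _                 = ≤ᵇ⇒≤ _ _ tt
exchange-≤ false true  false true  _                 = ≤ᵇ⇒≤ _ _ tt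
exchange-≤ false true  false false _                 = ≤ᵇ⇒≤ _ _ tt

-- Exchanging two lines

module Exchange (I : Instance) (l l' : L I) (l≢l' : l ≢ l') where
  open Instance I using (k)
  open Precedence I
  open AroundPair l l' l≢l'
  open import Data.List.Membership.DecPropositional (_≟_ {k}) using (_∈?_)

  τ : Fin k → Fin k
  τ = transpose l l'

  τ-l : τ l ≡ l'
  τ-l with l ≟ l
  ... | yes _   = refl
  ... | no l≢l = ⊥-elim (l≢l refl)

  τ-l' : τ l' ≡ l
  τ-l' with l' ≟ l
  ... | yes l'≡l = ⊥-elim (l≢l' (sym l'≡l))
  ... | no _ with l' ≟ l'
  ...   | yes _    = refl
  ...   | no l'≢l' = ⊥-elim (l'≢l' refl)

  τ-other : ∀ {i} → i ≢ l → i ≢ l' → τ i ≡ i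
  τ-other {i} i≢l i≢l' with i ≟ l
  ... | yes i≡l = ⊥-elim (i≢l i≡l)
  ... | no _ with i ≟ l'
  ...   | yes i≡l' = ⊥-elim (i≢l' i≡l')
  ...   | no _     = refl

  data Role (i : Fin k) : Set where
    is-l     : i ≡ l → Role i
    is-l'    : i ≡ l' → Role i
    is-other : i ≢ l → i ≢ l' → Role i

  role : ∀ i → Role i
  role i with i ≟ l | i ≟ l'
  ... | yes i≡l | _        = is-l i≡l
  ... | no _    | yes i≡l' = is-l' i≡l'
  ... | no i≢l  | no i≢l'  = is-other i≢l i≢l'

  τ-involutive : ∀ i → τ (τ i) ≡ i
  τ-involutive i with role i
  ... | is-l refl           rewrite τ-l  = τ-l'
  ... | is-l' refl          rewrite τ-l' = τ-l
  ... | is-other i≢l i≢l'  rewrite τ-other i≢l i≢l' = τ-other i≢l i≢l'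

  map-τ-id : ∀ {X} → l ∉ X → l' ∉ X → map τ X ≡ X
  map-τ-id {[]}    _   _    = refl
  map-τ-id {x ∷ X} l∉ l'∉ =
    cong₂ _∷_ (τ-other (λ x≡l → l∉ (here (sym x≡l))) (λ x≡l' → l'∉ (here (sym x≡l'))))
              (map-τ-id (l∉ ∘′ there) (l'∉ ∘′ there))

  map-τ-involutive : ∀ X → map τ (map τ X) ≡ X
  map-τ-involutive []      = refl
  map-τ-involutive (x ∷ X) = cong₂ _∷_ (τ-involutive x) (map-τ-involutive X)

  τ-injective : ∀ {i j} → τ i ≡ τ j → i ≡ j
  τ-injective {i} {j} eq = trans (sym (τ-involutive i)) (trans (cong τ eq) (τ-involutive j))

  ∈-map-τ : ∀ {i X} → i ∈ map τ X ⇔ τ i ∈ X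
  ∈-map-τ {i} = mk⇔ to (λ τi∈ → subst (_∈ _) (τ-involutive i) (∈-map⁺ τ τi∈))
    where
    to : ∀ {X} → i ∈ map τ X → τ i ∈ X
    to i∈ with x , x∈ , refl ← ∈-map⁻ τ i∈ = subst (_∈ _) (sym (τ-involutive x)) x∈

  τ-preserves : ∀ (P : Fin k → Set) → P l ⇔ P l' → ∀ i → P i → P (τ i)
  τ-preserves P Pl⇔Pl' i Pi with role i
  ... | is-l refl           rewrite τ-l  = Equivalence.to Pl⇔Pl' Pi
  ... | is-l' refl          rewrite τ-l' = Equivalence.from Pl⇔Pl' Pi
  ... | is-other i≢l i≢l'  rewrite τ-other i≢l i≢l' = Pi

  τ-reflects : ∀ (P : Fin k → Set) → P l ⇔ P l' → ∀ i → P (τ i) → P i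
  τ-reflects P Pl⇔Pl' i Pτi = subst P (τ-involutive i) (τ-preserves P Pl⇔Pl' (τ i) Pτi)

  data SameOrder (X Y : List (Fin k)) : Set where
    l-first  : Precedes l l' X → Precedes l l' Y → SameOrder X Y
    l'-first : Precedes l' l X → Precedes l' l Y → SameOrder X Y

  sameOrder-flip : ∀ {X Y} → SameOrder X Y → SameOrder Y X
  sameOrder-flip (l-first  ll'-X ll'-Y) = l-first  ll'-Y ll'-X
  sameOrder-flip (l'-first l'l-X l'l-Y) = l'-first l'l-Y l'l-X

  sameOrder-∈ : ∀ {X Y} → SameOrder X Y → l ∈ X × l' ∈ X
  sameOrder-∈ {X} (l-first ll'-X _) = precedes⇒∈ X ll'-X
  sameOrder-∈ {X} (l'-first l'l-X _) = Product.swap (precedes⇒∈ X l'l-X)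

  edgeCrossings-exchange-both : ∀ X Y → edgeCrossings (map τ X) (map τ Y) ≤ edgeCrossings X Y
  edgeCrossings-exchange-both X Y = ∑∑-mono F G block≤ strip≤ interior≤
    where
    F G : Fin k → Fin k → ℕ
    F = crossPair (map τ X) (map τ Y)
    G = crossPair X Y
    renamed : ∀ i j → F i j ≡ G (τ i) (τ j)
    renamed i j rewrite precedes-map τ τ-involutive i j X | precedes-map τ τ-involutive i j Y = refl
    block≤ : block F ≤ block G
    block≤ rewrite renamed l l | renamed l l' | renamed l' l | renamed l' l' | τ-l | τ-l' =
      ≤-reflexive (permute (G l' l') (G l' l) (G l l') (G l l))
      where
      permute : ∀ a b c d → a + b + (c + d) ≡ d + c + (b + a)
      permute = solve-∀
    strip≤ : ∀ m → m ≢ l → m ≢ l' → strip F m ≤ strip G m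
    strip≤ m m≢l m≢l' rewrite renamed l m | renamed l' m | renamed m l | renamed m l'
                            | τ-l | τ-l' | τ-other m≢l m≢l' =
      ≤-reflexive (permute (G l' m) (G l m) (G m l') (G m l))
      where
      permute : ∀ a b c d → a + b + (c + d) ≡ b + a + (d + c)
      permute = solve-∀
    interior≤ : ∀ i j → i ≢ l → i ≢ l' → j ≢ l → j ≢ l' → F i j ≤ G i j
    interior≤ i j i≢l i≢l' j≢l j≢l' rewrite renamed i j | τ-other i≢l i≢l' | τ-other j≢l j≢l' = ≤-refl

  module _ (X Y : List (Fin k)) (uX : Unique X) (uY : Unique Y) where

    private
      F G : Fin k → Fin k → ℕ
      F = crossPair (map τ X) Y
      G = crossPair X Y

      renamed : ∀ i j → F i j ≡ ind (precedes I (τ i) (τ j) X ∧ precedes I i j Y)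
      renamed i j rewrite precedes-map τ τ-involutive i j X = refl

    block-exchanged : SameOrder X Y → block F ≡ 0
    block-exchanged (l-first ll'-X ll'-Y)
      rewrite renamed l l | renamed l l' | renamed l' l | renamed l' l' | τ-l | τ-l'
            | precedes-irrefl {l} X uX | precedes-irrefl {l'} X uX
            | precedes-asym′ X uX ll'-X | precedes-asym′ Y uY ll'-Y | ∧-zeroʳ (precedes I l l' X) = refl
    block-exchanged (l'-first l'l-X l'l-Y)
      rewrite renamed l l | renamed l l' | renamed l' l | renamed l' l' | τ-l | τ-l'
            | precedes-irrefl {l} X uX | precedes-irrefl {l'} X uX
            | precedes-asym′ X uX l'l-X | precedes-asym′ Y uY l'l-Y | ∧-zeroʳ (precedes I l' l X) = refl

    block-crossed : SameOrder X Y → 1 ≤ block G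
    block-crossed (l-first ll'-X ll'-Y) =
      ≤-trans (≤-reflexive (sym crossed)) (≤-trans (m≤n+m (G l l') (G l l)) (m≤m+n _ _))
      where
      crossed : G l l' ≡ 1
      crossed rewrite Equivalence.to T-≡ ll'-X | Equivalence.to T-≡ ll'-Y = refl
    block-crossed (l'-first l'l-X l'l-Y) =
      ≤-trans (≤-reflexive (sym crossed)) (≤-trans (m≤m+n (G l' l) (G l' l')) (m≤n+m _ (G l l + G l l')))
      where
      crossed : G l' l ≡ 1
      crossed rewrite Equivalence.to T-≡ l'l-X | Equivalence.to T-≡ l'l-Y = refl

    strip-exchanged : (∀ {m} → m ∈ X → m ∈ Y) → l ∈ X → l' ∈ X → SameOrder X Y →
                      ∀ m → m ≢ l → m ≢ l' → strip F m ≤ strip G m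
    strip-exchanged X⊆Y l∈X l'∈X same m m≢l m≢l' with m ∈? X
    ... | no m∉X
      rewrite renamed l m | renamed l' m | renamed m l | renamed m l' | τ-l | τ-l' | τ-other m≢l m≢l'
            | precedes-∉ʳ {l} X m∉X | precedes-∉ʳ {l'} X m∉X
            | precedes-∉ˡ {j = l} X m∉X | precedes-∉ˡ {j = l'} X m∉X = z≤n
    ... | yes m∈X
      rewrite renamed l m | renamed l' m | renamed m l | renamed m l' | τ-l | τ-l' | τ-other m≢l m≢l'
            | precedes-flip X uX l∈X m∈X (m≢l ∘′ sym) | precedes-flip X uX l'∈X m∈X (m≢l' ∘′ sym)
            | precedes-flip Y uY (X⊆Y l∈X) (X⊆Y m∈X) (m≢l ∘′ sym)
            | precedes-flip Y uY (X⊆Y l'∈X) (X⊆Y m∈X) (m≢l' ∘′ sym) =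
      exchange-≤ (precedes I l m X) (precedes I l' m X) (precedes I l m Y) (precedes I l' m Y) (transported same)
      where
      transported : SameOrder X Y →
                    ((Precedes l' m X → Precedes l m X) × (Precedes l' m Y → Precedes l m Y))
                  ⊎ ((Precedes l m X → Precedes l' m X) × (Precedes l m Y → Precedes l' m Y))
      transported (l-first ll'-X ll'-Y) = inj₁ (precedes-trans X uX ll'-X , precedes-trans Y uY ll'-Y)
      transported (l'-first l'l-X l'l-Y) = inj₂ (precedes-trans X uX l'l-X , precedes-trans Y uY l'l-Y)

    interior-exchanged : ∀ i j → i ≢ l → i ≢ l' → j ≢ l → j ≢ l' → F i j ≤ G i j
    interior-exchanged i j i≢l i≢l' j≢l j≢l' rewrite renamed i j | τ-other i≢l i≢l' | τ-other j≢l j≢l' = ≤-refl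

    edgeCrossings-exchange-< : (∀ {m} → m ∈ X → m ∈ Y) → l ∈ X → l' ∈ X →
                               SameOrder X Y → edgeCrossings (map τ X) Y < edgeCrossings X Y
    edgeCrossings-exchange-< X⊆Y l∈X l'∈X same =
      ∑∑-mono-< F G block< (strip-exchanged X⊆Y l∈X l'∈X same) interior-exchanged
      where
      block< : block F < block G
      block< rewrite block-exchanged same = block-crossed same

module _ (I : Instance) {Λ Λ' : Layout I} {p : V I} {i j : L I} where

  vertexCross-≡ : πAt I Λ' p ≡ πAt I Λ p → VertexCross I Λ p i j → VertexCross I Λ' p i j
  vertexCross-≡ eq (r , (xs , ys , eq′ , refl) , sub) = r , (xs , ys , trans eq eq′ , refl) , sub

  vertexCross-map : ∀ (f : L I → L I) → πAt I Λ' p ≡ map f (πAt I Λ p) →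
                    VertexCross I Λ p i j → VertexCross I Λ' p (f i) (f j)
  vertexCross-map f eq (r , (xs , ys , eq′ , refl) , sub) =
    map f (ys ++ xs) ,
    (map f xs , map f ys , trans eq (trans (cong (map f) eq′) (map-++ f xs ys)) , map-++ f ys xs) ,
    Sublist.map⁺ f sub

module ExchangeAt (I : Instance) (l l' : L I) (l≢l' : l ≢ l') (Z : V I → Set) (Z? : Decidable Z)
  (same-edges : ∀ {p} → Z p → ∀ w → UsesEdge (Instance.line I l) p w ⇔ UsesEdge (Instance.line I l') p w)
  (same-terminal : ∀ {p} → Z p → Terminal I p l ⇔ Terminal I p l')
  (same-intermediate : ∀ {p} → Z p → Intermediate I p l ⇔ Intermediate I p l')
  where
  open Instance I
  open Layout
  open Precedence I
  open Exchange I l l' l≢l'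
  open import Data.List.Membership.DecPropositional (_≟_ {k}) using (_∈?_)

  exchangeIf : Bool → List (L I) → List (L I)
  exchangeIf b X = if b then map τ X else X

  exchangeAt : Layout I → Layout I
  exchangeAt Λ = record
    { π      = λ u v → exchangeIf (does (Z? u)) (π Λ u v)
    ; π-uniq = unique
    ; π-mem  = member
    }
    where
    unique : ∀ u v → Unique (exchangeIf (does (Z? u)) (π Λ u v))
    unique u v with Z? u
    ... | yes _ = Unique.map⁺ τ-injective (π-uniq Λ u v)
    ... | no _  = π-uniq Λ u v
    member : ∀ u v i → (i ∈ exchangeIf (does (Z? u)) (π Λ u v)) ⇔ UsesEdge (line i) u v
    member u v i with Z? u
    ... | no _  = π-mem Λ u v i
    ... | yes z = mk⇔
      (τ-reflects uses (same-edges z v) i ∘′ Equivalence.to (π-mem Λ u v (τ i)) ∘′ Equivalence.to ∈-map-τ)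
      (Equivalence.from ∈-map-τ ∘′ Equivalence.from (π-mem Λ u v (τ i)) ∘′ τ-preserves uses (same-edges z v) i)
      where
      uses : L I → Set
      uses j = UsesEdge (line j) u v

  πAt-exchangeAt-∈ : ∀ Λ {p} → Z p → πAt I (exchangeAt Λ) p ≡ map τ (πAt I Λ p)
  πAt-exchangeAt-∈ Λ {p} p∈Z with Z? p
  ... | yes _    = sym (map-concatMap τ (π Λ p) (rot p))
  ... | no p∉Z = ⊥-elim (p∉Z p∈Z)

  πAt-exchangeAt-∉ : ∀ Λ {p} → ¬ Z p → πAt I (exchangeAt Λ) p ≡ πAt I Λ p
  πAt-exchangeAt-∉ Λ {p} p∉Z with Z? p
  ... | yes p∈Z = ⊥-elim (p∉Z p∈Z)
  ... | no _     = refl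

  vertexCross-exchangeAt⁻ : ∀ Λ {p i j} → Z p → VertexCross I (exchangeAt Λ) p i j → VertexCross I Λ p (τ i) (τ j)
  vertexCross-exchangeAt⁻ Λ {p} p∈Z = vertexCross-map I {exchangeAt Λ} {Λ} τ
    (trans (sym (map-τ-involutive (πAt I Λ p))) (cong (map τ) (sym (πAt-exchangeAt-∈ Λ p∈Z))))

  -- At an exchanged vertex the vertex crossings are renamed by τ; feasibility of Λ is applied
  -- to the exchanged competitor.
  exchangeAt-feasible : ∀ Λ → Feasible I Λ → Feasible I (exchangeAt Λ)
  exchangeAt-feasible Λ feasible p i j crossing Λ″ = by-cases (Z? p)
    where
    by-cases : Dec (Z p) → VertexCross I Λ″ p i j
    by-cases (no p∉Z) = feasible p i j (vertexCross-≡ I {exchangeAt Λ} {Λ} (sym (πAt-exchangeAt-∉ Λ p∉Z)) crossing) Λ″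
    by-cases (yes p∈Z) = subst₂ (VertexCross I Λ″ p) (τ-involutive i) (τ-involutive j)
      (vertexCross-exchangeAt⁻ Λ″ p∈Z
        (feasible p (τ i) (τ j) (vertexCross-exchangeAt⁻ Λ p∈Z crossing) (exchangeAt Λ″)))

  exchangeAt-periphery : ∀ Λ → Periphery I Λ → Periphery I (exchangeAt Λ)
  exchangeAt-periphery Λ periphery u v with Z? u | periphery u v
  ... | no _  | split = split
  ... | yes z | A , B , C , eq , terminalA , intermediateB , terminalC =
    map τ A , map τ B , map τ C ,
    trans (cong (map τ) eq) (trans (map-++ τ A (B ++ C)) (cong (map τ A ++_) (map-++ τ B C))) ,
    All.map⁺ (All.map (τ-preserves (Terminal I u) (same-terminal z) _) terminalA) ,
    All.map⁺ (All.map (τ-preserves (Intermediate I u) (same-intermediate z) _) intermediateB) ,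
    All.map⁺ (All.map (τ-preserves (Terminal I u) (same-terminal z) _) terminalC)

  module _ (Λ : Layout I)
    (boundary-sameOrder : ∀ {x y} → Z x → ¬ Z y → l ∈ π Λ x y → SameOrder (π Λ x y) (π Λ y x)) where

    private
      ∈-flip : ∀ {m u v} → m ∈ π Λ u v → m ∈ π Λ v u
      ∈-flip {m} {u} {v} = Equivalence.from (π-mem Λ v u m) ∘′ usesEdge-sym ∘′ Equivalence.to (π-mem Λ u v m)

      l∈⇒l'∈ : ∀ {u v} → Z u → l ∈ π Λ u v → l' ∈ π Λ u v
      l∈⇒l'∈ {u} {v} u∈Z =
        Equivalence.from (π-mem Λ u v l') ∘′ Equivalence.to (same-edges u∈Z v) ∘′ Equivalence.to (π-mem Λ u v l)

      l'∈⇒l∈ : ∀ {u v} → Z u → l' ∈ π Λ u v → l ∈ π Λ u v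
      l'∈⇒l∈ {u} {v} u∈Z =
        Equivalence.from (π-mem Λ u v l) ∘′ Equivalence.from (same-edges u∈Z v) ∘′ Equivalence.to (π-mem Λ u v l')

    boundary-< : ∀ {u v} → Z u → ¬ Z v → l ∈ π Λ u v →
                 edgeCrossings (map τ (π Λ u v)) (π Λ v u) < edgeCrossings (π Λ u v) (π Λ v u)
    boundary-< {u} {v} u∈Z v∉Z l∈ =
      edgeCrossings-exchange-< (π Λ u v) (π Λ v u) (π-uniq Λ u v) (π-uniq Λ v u) ∈-flip
        l∈ (l∈⇒l'∈ u∈Z l∈) (boundary-sameOrder u∈Z v∉Z l∈)

    boundary-≤ : ∀ {u v} → Z u → ¬ Z v →
                 edgeCrossings (map τ (π Λ u v)) (π Λ v u) ≤ edgeCrossings (π Λ u v) (π Λ v u)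
    boundary-≤ {u} {v} u∈Z v∉Z with l ∈? π Λ u v
    ... | yes l∈ = <⇒≤ (boundary-< u∈Z v∉Z l∈)
    ... | no l∉  rewrite map-τ-id l∉ (l∉ ∘′ l'∈⇒l∈ u∈Z) = ≤-refl

    boundary-≤′ : ∀ {u v} → ¬ Z u → Z v →
                  edgeCrossings (π Λ u v) (map τ (π Λ v u)) ≤ edgeCrossings (π Λ u v) (π Λ v u)
    boundary-≤′ {u} {v} u∉Z v∈Z =
      subst₂ _≤_ (edgeCrossings-comm (map τ (π Λ v u)) (π Λ u v)) (edgeCrossings-comm (π Λ v u) (π Λ u v))
        (boundary-≤ v∈Z u∉Z)

    edge-≤ : ∀ u v → edgeCrossings (exchangeIf (does (Z? u)) (π Λ u v)) (exchangeIf (does (Z? v)) (π Λ v u))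
                       ≤ edgeCrossings (π Λ u v) (π Λ v u)
    edge-≤ u v with Z? u | Z? v
    ... | yes _   | yes _   = edgeCrossings-exchange-both (π Λ u v) (π Λ v u)
    ... | yes u∈Z | no v∉Z = boundary-≤ u∈Z v∉Z
    ... | no u∉Z  | yes v∈Z = boundary-≤′ u∉Z v∈Z
    ... | no _    | no _    = ≤-refl

    edge-< : ∀ {u v} → Z u → ¬ Z v → l ∈ π Λ u v →
             edgeCrossings (exchangeIf (does (Z? u)) (π Λ u v)) (exchangeIf (does (Z? v)) (π Λ v u))
               < edgeCrossings (π Λ u v) (π Λ v u)
    edge-< {u} {v} u∈Z v∉Z l∈ with Z? u | Z? v
    ... | no u∉Z | _       = ⊥-elim (u∉Z u∈Z)
    ... | _      | yes v∈Z = ⊥-elim (v∉Z v∈Z)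
    ... | yes _  | no _    = boundary-< u∈Z v∉Z l∈

    edge-<′ : ∀ {u v} → Z u → ¬ Z v → l ∈ π Λ u v →
              edgeCrossings (exchangeIf (does (Z? v)) (π Λ v u)) (exchangeIf (does (Z? u)) (π Λ u v))
                < edgeCrossings (π Λ v u) (π Λ u v)
    edge-<′ {u} {v} u∈Z v∉Z l∈ =
      subst₂ _<_ (edgeCrossings-comm (exchangeIf (does (Z? u)) (π Λ u v)) (exchangeIf (does (Z? v)) (π Λ v u)))
                 (edgeCrossings-comm (π Λ u v) (π Λ v u)) (edge-< u∈Z v∉Z l∈)

    -- crossings I Λ unfolds to ∑< of the per-edge counts edgeCrossings (π Λ u v) (π Λ v u).
    exchangeAt-crossings-< : ∀ {a b} → Z a → ¬ Z b → l ∈ π Λ a b → crossings I (exchangeAt Λ) < crossings I Λ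
    exchangeAt-crossings-< {a} {b} a∈Z b∉Z l∈ =
      ∑<-mono-< {f = λ u v → edgeCrossings (π (exchangeAt Λ) u v) (π (exchangeAt Λ) v u)}
                {g = λ u v → edgeCrossings (π Λ u v) (π Λ v u)}
                (λ { refl → b∉Z a∈Z }) edge-≤ (edge-< a∈Z b∉Z l∈) (edge-<′ a∈Z b∉Z l∈)

-- Untangling

descend : ∀ {A : Set} (μ : A → ℕ) (Inv Bad : A → Set) → (∀ x → Dec (Bad x)) →
          (∀ x → Inv x → Bad x → ∃ λ y → Inv y × μ y < μ x) →
          ∀ x → Inv x → Bad x → ∃ λ y → Inv y × μ y < μ x × ¬ Bad y
descend {A} μ Inv Bad Bad? improve = wfRec Goal go
  where
  open WF.All (On.wellFounded μ <-wellFounded) 0ℓ using (wfRec)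
  Goal : A → Set
  Goal x = Inv x → Bad x → ∃ λ y → Inv y × μ y < μ x × ¬ Bad y
  go : ∀ x → (∀ {y} → μ y < μ x → Goal y) → Goal x
  go x rec inv bad with y , inv-y , y<x ← improve x inv bad with Bad? y
  ... | no ¬bad = y , inv-y , y<x , ¬bad
  ... | yes bad-y with z , inv-z , z<y , ¬bad-z ← rec y<x inv-y bad-y = z , inv-z , <-trans z<y y<x , ¬bad-z

cross? : ∀ I (Λ : Layout I) l l' → Dec (Cross I Λ l l')
cross? I Λ l l' = any? λ u → any? λ v → T? (edgeCrossᵇ I Λ u v l l') ⊎-dec T? (edgeCrossᵇ I Λ u v l' l)

orient-commonSubpath : ∀ {A : Set} {L L' P : List A} {v} → TheCommonSubpath L L' P → EndpointOf v P →
  ∃ λ R → SubpathOf (v ∷ R) L × SubpathOf (v ∷ R) L' ×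
          (∀ {x y} → UsesEdge L x y → UsesEdge L' x y → UsesEdge (v ∷ R) x y)
orient-commonSubpath ((_ , P-in-L , P-in-L') , maximal) (inj₁ (R , refl)) =
  R , P-in-L , P-in-L' , λ e e' → maximal (_ ∷ _ ∷ []) ((λ ()) , e , e')
orient-commonSubpath {v = v} ((_ , P-in-L , P-in-L') , maximal) (inj₂ (R , refl)) =
  reverse R , reoriented P-in-L , reoriented P-in-L' ,
  λ e e' → subst (λ Q → UsesEdge Q _ _) reversed (usesEdge-reverse (maximal (_ ∷ _ ∷ []) ((λ ()) , e , e')))
  where
  reversed : reverse (R ∷ʳ v) ≡ v ∷ reverse R
  reversed = reverse-++ R (v ∷ [])
  reoriented : ∀ {M} → SubpathOf (R ∷ʳ v) M → SubpathOf (v ∷ reverse R) M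
  reoriented {M} = subst (λ Q → SubpathOf Q M) reversed ∘′ subpath-reverse

module Untangle (I : Instance) (l l' : L I) (l≢l' : l ≢ l') (v : V I) (R : List (V I))
  (Q-in-l  : SubpathOf (v ∷ R) (Instance.line I l))
  (Q-in-l' : SubpathOf (v ∷ R) (Instance.line I l'))
  (common-in-Q : ∀ {x y} → UsesEdge (Instance.line I l) x y → UsesEdge (Instance.line I l') x y →
                 UsesEdge (v ∷ R) x y)
  (v-terminal-l : Terminal I v l) (v-terminal-l' : Terminal I v l')
  where
  open Instance I
  open Layout
  open Precedence I
  open Exchange I l l' l≢l'
  open import Data.List.Membership.DecPropositional (_≟_ {n}) using (_∈?_)

  Q : List (V I)
  Q = v ∷ R

  unique-Q : Unique Q
  unique-Q = unique-subpath (line-simple l) Q-in-l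

  nonLast-role : ∀ {p} s₁ {ys} → Q ≡ s₁ ++ p ∷ ys → ys ≢ [] → p ≡ v ⊎ (Intermediate I p l × Intermediate I p l')
  nonLast-role []      Q≡ _     = inj₁ (sym (∷-injectiveˡ Q≡))
  nonLast-role s₁@(_ ∷ _) Q≡ ys≢[] =
    inj₂ (subpath⇒inner {xs = s₁} (subst (λ q → SubpathOf q (line l)) Q≡ Q-in-l) (λ ()) ys≢[] ,
          subpath⇒inner {xs = s₁} (subst (λ q → SubpathOf q (line l')) Q≡ Q-in-l') (λ ()) ys≢[])

  module _ {p s₁ ys} (Q≡ : Q ≡ s₁ ++ p ∷ ys) (ys≢[] : ys ≢ []) where

    nonLast-edges : ∀ w → UsesEdge (line l) p w ⇔ UsesEdge (line l') p w
    nonLast-edges w = mk⇔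
      (λ e → usesEdge-subpath (subpathFromEndpoint-usesEdge (line-simple l) v-terminal-l Q-in-l Q≡ ys≢[] e) Q-in-l')
      (λ e → usesEdge-subpath (subpathFromEndpoint-usesEdge (line-simple l') v-terminal-l' Q-in-l' Q≡ ys≢[] e) Q-in-l)

    nonLast-terminal : Terminal I p l ⇔ Terminal I p l'
    nonLast-terminal with nonLast-role s₁ Q≡ ys≢[]
    ... | inj₁ refl = mk⇔ (λ _ → v-terminal-l') (λ _ → v-terminal-l)
    ... | inj₂ (inner , inner') = mk⇔ (λ t → ⊥-elim (endpoint⇒¬inner (line-simple l) t inner))
                                      (λ t → ⊥-elim (endpoint⇒¬inner (line-simple l') t inner'))

    nonLast-intermediate : Intermediate I p l ⇔ Intermediate I p l'
    nonLast-intermediate with nonLast-role s₁ Q≡ ys≢[]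
    ... | inj₁ refl = mk⇔ (⊥-elim ∘′ endpoint⇒¬inner (line-simple l) v-terminal-l)
                          (⊥-elim ∘′ endpoint⇒¬inner (line-simple l') v-terminal-l')
    ... | inj₂ (inner , inner') = mk⇔ (λ _ → inner') (λ _ → inner)

  module AtEdge (pre : List (V I)) (a b : V I) (post : List (V I)) (Q≡ : Q ≡ pre ++ a ∷ b ∷ post) where

    Z : V I → Set
    Z p = p ∈ pre ∷ʳ a

    Q≡′ : Q ≡ (pre ∷ʳ a) ++ b ∷ post
    Q≡′ = trans Q≡ (sym (++-assoc pre (a ∷ []) (b ∷ post)))

    nonLast : ∀ {p} → Z p → ∃₂ λ s₁ ys → Q ≡ s₁ ++ p ∷ ys × ys ≢ []
    nonLast p∈Z with s₁ , s₂ , eq ← ∈-∃++ p∈Z =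
      s₁ , s₂ ++ b ∷ post , trans Q≡′ (split-++ eq) , (λ ()) ∘′ ++-conicalʳ s₂ (b ∷ post)

    same-edges : ∀ {p} → Z p → ∀ w → UsesEdge (line l) p w ⇔ UsesEdge (line l') p w
    same-edges p∈Z with _ , _ , eq , ys≢[] ← nonLast p∈Z = nonLast-edges eq ys≢[]

    same-terminal : ∀ {p} → Z p → Terminal I p l ⇔ Terminal I p l'
    same-terminal p∈Z with _ , _ , eq , ys≢[] ← nonLast p∈Z = nonLast-terminal eq ys≢[]

    same-intermediate : ∀ {p} → Z p → Intermediate I p l ⇔ Intermediate I p l'
    same-intermediate p∈Z with _ , _ , eq , ys≢[] ← nonLast p∈Z = nonLast-intermediate eq ys≢[]

    open ExchangeAt I l l' l≢l' Z (_∈? pre ∷ʳ a) same-edges same-terminal same-intermediate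

    a∈Z : Z a
    a∈Z = ∈-++⁺ʳ pre (here refl)

    b∉Z : ¬ Z b
    b∉Z b∈Z = unique-++-disjoint (pre ∷ʳ a) (subst Unique Q≡′ unique-Q) b∈Z (here refl)

    -- l and l' agree on the edges at Z, so such an edge is a common edge and hence lies on Q.
    leaving-edge : ∀ {x y} → Z x → ¬ Z y → UsesEdge (line l) x y → x ≡ a × y ≡ b
    leaving-edge {x} {y} x∈Z y∉Z e = usesEdge-leaving pre (subst Unique Q≡′ unique-Q) x∈Z y∉Z
      (subst (λ q → UsesEdge q x y) Q≡′ (common-in-Q e (Equivalence.to (same-edges x∈Z y) e)))

    boundary-sameOrder : ∀ (Λ : Layout I) → SameOrder (π Λ a b) (π Λ b a) →
                         ∀ {x y} → Z x → ¬ Z y → l ∈ π Λ x y → SameOrder (π Λ x y) (π Λ y x)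
    boundary-sameOrder Λ same {x} {y} x∈Z y∉Z l∈
      with refl , refl ← leaving-edge x∈Z y∉Z (Equivalence.to (π-mem Λ x y l) l∈) = same

    l∈πab : ∀ (Λ : Layout I) → l ∈ π Λ a b
    l∈πab Λ = Equivalence.from (π-mem Λ a b l) (usesEdge-subpath (inj₁ (pre , post , Q≡)) Q-in-l)

    improve : ∀ Λ → Feasible I Λ → Periphery I Λ → SameOrder (π Λ a b) (π Λ b a) →
              Σ (Layout I) λ Λ' → (Feasible I Λ' × Periphery I Λ') × crossings I Λ' < crossings I Λ
    improve Λ feasible periphery same =
      exchangeAt Λ , (exchangeAt-feasible Λ feasible , exchangeAt-periphery Λ periphery) ,
      exchangeAt-crossings-< Λ (boundary-sameOrder Λ same) a∈Z b∉Z (l∈πab Λ)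

  crossing-on-Q : ∀ Λ → Cross I Λ l l' →
                  ∃₂ λ pre a → ∃₂ λ b post → Q ≡ pre ++ a ∷ b ∷ post × SameOrder (π Λ a b) (π Λ b a)
  crossing-on-Q Λ (u , w , crossed) = located (sameOrder crossed)
    where
    sameOrder : T (edgeCrossᵇ I Λ u w l l') ⊎ T (edgeCrossᵇ I Λ u w l' l) → SameOrder (π Λ u w) (π Λ w u)
    sameOrder (inj₁ ll') = Product.uncurry l-first (Equivalence.to T-∧ ll')
    sameOrder (inj₂ l'l) = Product.uncurry l'-first (Equivalence.to T-∧ l'l)
    located : SameOrder (π Λ u w) (π Λ w u) →
              ∃₂ λ pre a → ∃₂ λ b post → Q ≡ pre ++ a ∷ b ∷ post × SameOrder (π Λ a b) (π Λ b a)
    located same with common-in-Q (Equivalence.to (π-mem Λ u w l) (proj₁ (sameOrder-∈ same)))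
                                  (Equivalence.to (π-mem Λ u w l') (proj₂ (sameOrder-∈ same)))
    ... | inj₁ (pre , post , Q≡) = pre , u , w , post , Q≡ , same
    ... | inj₂ (pre , post , Q≡) = pre , w , u , post , Q≡ , sameOrder-flip same

  untangle-step : ∀ Λ → Feasible I Λ × Periphery I Λ → Cross I Λ l l' →
                  Σ (Layout I) λ Λ' → (Feasible I Λ' × Periphery I Λ') × crossings I Λ' < crossings I Λ
  untangle-step Λ (feasible , periphery) crossing
    with pre , a , b , post , Q≡ , same ← crossing-on-Q Λ crossing
    = AtEdge.improve pre a b post Q≡ Λ feasible periphery same

  untangle : ∀ Λ → Feasible I Λ → Periphery I Λ → Cross I Λ l l' →
             Σ (Layout I) λ Λ' → Feasible I Λ' × Periphery I Λ' × crossings I Λ' < crossings I Λ × ¬ Cross I Λ' l l'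
  untangle Λ feasible periphery crossing =
    reassociate (descend (crossings I) (λ Λ → Feasible I Λ × Periphery I Λ) (λ Λ → Cross I Λ l l')
                         (λ Λ → cross? I Λ l l') untangle-step Λ (feasible , periphery) crossing)
    where
    reassociate : (∃ λ Λ' → (Feasible I Λ' × Periphery I Λ') × crossings I Λ' < crossings I Λ × ¬ Cross I Λ' l l') →
                  Σ (Layout I) λ Λ' → Feasible I Λ' × Periphery I Λ' × crossings I Λ' < crossings I Λ × ¬ Cross I Λ' l l'
    reassociate (Λ' , (feasible' , periphery') , fewer , uncrossed) = Λ' , feasible' , periphery' , fewer , uncrossed

lemma2 : (I : Instance) (Λ : Layout I) →
         Feasible I Λ → Periphery I Λ →
         (l l' : L I) → l ≢ l' →
         (P : List (V I)) → TheCommonSubpath (Instance.line I l) (Instance.line I l') P →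
         (v : V I) → EndpointOf v P → Terminal I v l → Terminal I v l' →
         Cross I Λ l l' →
         Σ (Layout I) λ Λ' → Feasible I Λ' × Periphery I Λ' ×
           crossings I Λ' < crossings I Λ × ¬ Cross I Λ' l l'
lemma2 I Λ feasible periphery l l' l≢l' P common v v-end v-terminal-l v-terminal-l' crossing =
  let R , Q-in-l , Q-in-l' , common-in-Q = orient-commonSubpath common v-end
  in Untangle.untangle I l l' l≢l' v R Q-in-l Q-in-l' common-in-Q v-terminal-l v-terminal-l'
       Λ feasible periphery crossing
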